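{- Let $N$ be a chemical reaction network containing the reaction $y\to y'$ with $y'\ne\varnothing$. Then the vertex $u$ of $\mathcal H_N$ corresponding to $y$ in the reaction $y\to y'$ is almost balanced if and only if the vertex $v$ of $\mathcal H_N$ corresponding to $y'$ in the reaction $y\to y'$ is almost balanced.
   Context: A chemical reaction network $N=(\mathscr S,\mathscr C,\mathscr R)$ consists of a finite set of species $\mathscr S$, complexes $\mathscr C\subseteq\mathbb Z_{\ge0}^{\mathscr S}$, and reactions $y\to y'$ with $y\ne y'$; every complex occurs in some reaction, every species lies in some complex's support, and there are no reactions $\varnothing\to y$ ($\varnothing$ is the zero complex). Reactions are indexed $1,\dots,m$, the $i$-th written $y_i\to y_i'$. The network hypergraph $\mathcal H_N$ has $2m$ vertices $u_1,v_1,\dots,u_m,v_m$ ($u_i$ corresponds to the reactant $y_i$ of reaction $i$, $v_i$ to its product $y_i'$). Hyperedges: for each species $s$, $E_s=\{u_i: s\in\mathrm{supp}(y_i)\}\cup\{v_i: s\in\mathrm{supp}(y_i')\}$; for each reaction $i$, $E_i=\{u_i,v_i\}$ if $y_i'\ne\varnothing$ and $E_i=\varnothing$ otherwise. A vertex $w$ is almost balanced if there is a multiset $\mathscr E$ of edges (nonnegative multiplicities) and a splitting $\mathscr E=\mathscr E_r\sqcup\mathscr E_b$ into two submultisets whose multiplicities add up, such that, writing $\deg_{\mathscr E_c}(z)$ for the number of edges of $\mathscr E_c$ (with multiplicity) containing $z$, $\deg_{\mathscr E_r}(w)=\deg_{\mathscr E_b}(w)+k$ for some positive integer $k$ and $\deg_{\mathscr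 E_r}(z)=\deg_{\mathscr E_b}(z)$ for every other vertex $z$. -}

module Defs where

open import Data.Nat using (ℕ; zero; suc; _+_; _*_; _<_)
open import Data.Nat.Properties using (_≟_)
open import Data.Fin using (Fin)
open import Data.Fin.Properties using () renaming (_≟_ to _≟ᶠ_)
open import Data.Product using (_×_; Σ; ∃; ∃-syntax; _,_)
open import Data.Sum using (_⊎_; inj₁; inj₂)
open import Data.Bool using (Bool; true; false; _∧_)
open import Data.List using (tabulate; allFin)
open import Data.Nat.ListAction using (sum)
open import Data.Bool.ListAction using (any)
open import Relation.Nullary using (¬_; does)
open import Relation.Binary.PropositionalEquality using (_≡_)

Complex : ℕ → Set
Complex n = Fin n → ℕ

IsZeroComplex : ∀ {n} → Complex n → Set
IsZeroComplex y = ∀ s → y s ≡ 0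

-- The set of complexes is the set of
-- complexes occurring in reactions (so "every complex occurs in a reaction" holds
-- by construction).
record CRN (n m : ℕ) : Set where
  field
    reactant : Fin m → Complex n
    product  : Fin m → Complex n
    nontrivial : ∀ i → ¬ (∀ s → reactant i s ≡ product i s)
    reactant-nonzero : ∀ i → ¬ IsZeroComplex (reactant i)
    species-used : ∀ s → ∃[ i ] (¬ reactant i s ≡ 0 ⊎ ¬ product i s ≡ 0)

open CRN public

-- Vertices of the network hypergraph: u i (reactant of reaction i), v i (product).
data Vertex (m : ℕ) : Set where
  u : Fin m → Vertex m
  v : Fin m → Vertex m

-- Hyperedge indices: E_s for each species s, E_i for each reaction i.
EdgeIx : ℕ → ℕ → Set
EdgeIx n m = Fin n ⊎ Fin m

inSupp : ∀ {n} → Complex n → Fin n → Bool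
inSupp y s = Data.Bool.not (does (y s ≟ 0))
  where import Data.Bool

nonzeroComplex : ∀ {n} → Complex n → Bool
nonzeroComplex {n} y = any (inSupp y) (allFin n)

member : ∀ {n m} → CRN n m → Vertex m → EdgeIx n m → Bool
member N (u i) (inj₁ s) = inSupp (reactant N i) s
member N (v i) (inj₁ s) = inSupp (product N i) s
member N (u i) (inj₂ j) = does (i ≟ᶠ j) ∧ nonzeroComplex (product N j)
member N (v i) (inj₂ j) = does (i ≟ᶠ j) ∧ nonzeroComplex (product N j)

indicator : Bool → ℕ
indicator true  = 1
indicator false = 0

EdgeMultiset : ℕ → ℕ → Set
EdgeMultiset n m = EdgeIx n m → ℕ

deg : ∀ {n m} → CRN n m → EdgeMultiset n m → Vertex m → ℕ
deg {n} {m} N E z =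
  sum (tabulate {n = n} (λ s → E (inj₁ s) * indicator (member N z (inj₁ s))))
  + sum (tabulate {n = m} (λ j → E (inj₂ j) * indicator (member N z (inj₂ j))))

-- w is almost balanced: there is a multiset of edges split into E_r ⊔ E_b
-- (given by the two multiplicity functions; E = E_r + E_b pointwise) such that
-- deg_r(w) = deg_b(w) + k for some k > 0 and deg_r(z) = deg_b(z) for z ≠ w.
AlmostBalanced : ∀ {n m} → CRN n m → Vertex m → Set
AlmostBalanced N w =
  Σ (EdgeMultiset _ _) λ Er → Σ (EdgeMultiset _ _) λ Eb → Σ ℕ λ k →
    (0 < k) × (deg N Er w ≡ deg N Eb w + k)
    × (∀ z → ¬ z ≡ w → deg N Er z ≡ deg N Eb z)

-- Adding k copies of the reaction edge E_i = {u_i, v_i} to one side of a splitting raises the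
-- degree of u_i and of v_i on that side by k and leaves every other degree unchanged. So if
-- (E_r, E_b) exhibits u_i as almost balanced with excess k, then (E_b + k·E_i, E_r) exhibits
-- v_i as almost balanced with the same excess, and symmetrically.
module Submission where

open import Defs
open import Data.Nat using (ℕ; zero; suc; _+_; _*_)
open import Data.Nat.Properties
  using (_≟_; +-identityʳ; *-identityʳ; *-zeroʳ; *-distribʳ-+; +-commutativeSemigroup)
open import Algebra.Properties.CommutativeSemigroup +-commutativeSemigroup using (interchange)
open import Data.Fin using (Fin) renaming (zero to fzero; suc to fsuc)
open import Data.Fin.Properties using (suc-injective) renaming (_≟_ to _≟ᶠ_)
open import Data.Product using (_×_; _,_; proj₁; proj₂)
open import Data.Sum using (_⊎_; inj₁; inj₂; [_,_]′; swap)
open import Data.Sum.Properties using (≡-dec; inj₁-injective; inj₂-injective)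
open import Data.Bool using (true; false; T)
open import Data.Unit using (tt)
open import Data.List using (tabulate)
open import Data.List.Properties using (tabulate-cong)
open import Data.List.Membership.Propositional using (lose)
open import Data.List.Membership.Propositional.Properties using (∈-allFin)
open import Data.List.Relation.Unary.Any.Properties using (any⁺)
open import Data.Nat.ListAction using (sum)
open import Function using (_∘_)
open import Function.Bundles using (_⇔_; mk⇔)
open import Relation.Nullary using (¬_; does; yes; no; contradiction)
open import Relation.Nullary.Decidable using (T?; dec-true; dec-false; decidable-stable; map′)
open import Relation.Binary.Definitions using (DecidableEquality)
open import Relation.Binary.PropositionalEquality using (_≡_; refl; sym; cong; cong₂; _≗_)
open import Relation.Binary.PropositionalEquality using (module ≡-Reasoning)
open ≡-Reasoning

∑ : ∀ {m} → (Fin m → ℕ) → ℕ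
∑ f = sum (tabulate f)

∑-cong : ∀ {m} {f g : Fin m → ℕ} → f ≗ g → ∑ f ≡ ∑ g
∑-cong = cong sum ∘ tabulate-cong

∑-distrib-+ : ∀ {m} (f g : Fin m → ℕ) → ∑ (λ j → f j + g j) ≡ ∑ f + ∑ g
∑-distrib-+ {zero}  f g = refl
∑-distrib-+ {suc m} f g = begin
  f fzero + g fzero + ∑ (λ j → f (fsuc j) + g (fsuc j))
    ≡⟨ cong (f fzero + g fzero +_) (∑-distrib-+ (f ∘ fsuc) (g ∘ fsuc)) ⟩
  f fzero + g fzero + (∑ (f ∘ fsuc) + ∑ (g ∘ fsuc))
    ≡⟨ interchange (f fzero) (g fzero) _ _ ⟩
  ∑ f + ∑ g ∎

∑-zero : ∀ {m} (f : Fin m → ℕ) → (∀ j → f j ≡ 0) → ∑ f ≡ 0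
∑-zero {zero}  f f≡0 = refl
∑-zero {suc m} f f≡0 = cong₂ _+_ (f≡0 fzero) (∑-zero (f ∘ fsuc) (f≡0 ∘ fsuc))

∑-single : ∀ {m} (i : Fin m) (f : Fin m → ℕ) → (∀ j → ¬ j ≡ i → f j ≡ 0) → ∑ f ≡ f i
∑-single fzero f off = begin
  f fzero + ∑ (f ∘ fsuc) ≡⟨ cong (f fzero +_) (∑-zero (f ∘ fsuc) (λ j → off (fsuc j) λ ())) ⟩
  f fzero + 0            ≡⟨ +-identityʳ (f fzero) ⟩
  f fzero                ∎
∑-single (fsuc i) f off = begin
  f fzero + ∑ (f ∘ fsuc) ≡⟨ cong₂ _+_ (off fzero λ ()) (∑-single i (f ∘ fsuc) λ j j≢i → off (fsuc j) (j≢i ∘ suc-injective)) ⟩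
  0 + f (fsuc i)         ∎

indicator-T : ∀ b → T b → indicator b ≡ 1
indicator-T true _ = refl

indicator-¬T : ∀ b → ¬ T b → indicator b ≡ 0
indicator-¬T true  ¬t = contradiction tt ¬t
indicator-¬T false _  = refl

¬inSupp⇒zero : ∀ {n} (y : Complex n) s → ¬ T (inSupp y s) → y s ≡ 0
¬inSupp⇒zero y s ¬t with y s
... | zero  = refl
... | suc _ = contradiction tt ¬t

nonzeroComplex-holds : ∀ {n} {y : Complex n} → ¬ IsZeroComplex y → T (nonzeroComplex y)
nonzeroComplex-holds {y = y} y≢∅ = decidable-stable (T? _) λ ¬t →
  y≢∅ λ s → ¬inSupp⇒zero y s (¬t ∘ any⁺ (inSupp y) ∘ lose (∈-allFin s))

_≟ⱽ_ : ∀ {m} → DecidableEquality (Vertex m)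
u i ≟ⱽ u j = map′ (cong u) (λ { refl → refl }) (i ≟ᶠ j)
v i ≟ⱽ v j = map′ (cong v) (λ { refl → refl }) (i ≟ᶠ j)
u _ ≟ⱽ v _ = no λ ()
v _ ≟ⱽ u _ = no λ ()

module EdgeMultisets {n m : ℕ} where

  _≟ᴱ_ : DecidableEquality (EdgeIx n m)
  _≟ᴱ_ = ≡-dec _≟ᶠ_ _≟ᶠ_

  _+ᴹ_ : EdgeMultiset n m → EdgeMultiset n m → EdgeMultiset n m
  (E +ᴹ F) e = E e + F e

  pointMass : ℕ → EdgeIx n m → EdgeMultiset n m
  pointMass k e e′ = k * indicator (does (e′ ≟ᴱ e))

  pointMass-off : ∀ k e e′ {x} → ¬ e′ ≡ e → pointMass k e e′ * x ≡ 0
  pointMass-off k e e′ e′≢e rewrite dec-false (e′ ≟ᴱ e) e′≢e | *-zeroʳ k = refl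

  pointMass-at : ∀ k e x → pointMass k e e * x ≡ k * x
  pointMass-at k e x with e ≟ᴱ e
  ... | yes _  = cong (_* x) (*-identityʳ k)
  ... | no e≢e = contradiction refl e≢e

module _ {n m : ℕ} (N : CRN n m) where

  open EdgeMultisets {n} {m}

  deg-+ᴹ : ∀ E F z → deg N (E +ᴹ F) z ≡ deg N E z + deg N F z
  deg-+ᴹ E F z = begin
    ∑ (λ s → (E (inj₁ s) + F (inj₁ s)) * c (inj₁ s)) + ∑ (λ j → (E (inj₂ j) + F (inj₂ j)) * c (inj₂ j))
      ≡⟨ cong₂ _+_ (split inj₁) (split inj₂) ⟩
    ∑ (E′ ∘ inj₁) + ∑ (F′ ∘ inj₁) + (∑ (E′ ∘ inj₂) + ∑ (F′ ∘ inj₂))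
      ≡⟨ interchange (∑ (E′ ∘ inj₁)) (∑ (F′ ∘ inj₁)) (∑ (E′ ∘ inj₂)) (∑ (F′ ∘ inj₂)) ⟩
    deg N E z + deg N F z ∎
    where
    c : EdgeIx n m → ℕ
    c e = indicator (member N z e)
    E′ F′ : EdgeIx n m → ℕ
    E′ e = E e * c e
    F′ e = F e * c e
    split : ∀ {l} (ι : Fin l → EdgeIx n m) →
            ∑ (λ j → (E (ι j) + F (ι j)) * c (ι j)) ≡ ∑ (E′ ∘ ι) + ∑ (F′ ∘ ι)
    split ι = begin
      ∑ (λ j → (E (ι j) + F (ι j)) * c (ι j)) ≡⟨ ∑-cong (λ j → *-distribʳ-+ (c (ι j)) (E (ι j)) (F (ι j))) ⟩
      ∑ (λ j → E′ (ι j) + F′ (ι j))           ≡⟨ ∑-distrib-+ (E′ ∘ ι) (F′ ∘ ι) ⟩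
      ∑ (E′ ∘ ι) + ∑ (F′ ∘ ι)                 ∎

  deg-pointMass : ∀ k e z → deg N (pointMass k e) z ≡ k * indicator (member N z e)
  deg-pointMass k (inj₁ s) z = begin
    ∑ (term ∘ inj₁) + ∑ (term ∘ inj₂)
      ≡⟨ cong₂ _+_ (∑-single s (term ∘ inj₁) λ s′ s′≢s → pointMass-off k (inj₁ s) (inj₁ s′) (s′≢s ∘ inj₁-injective))
                   (∑-zero (term ∘ inj₂) λ j → pointMass-off k (inj₁ s) (inj₂ j) λ ()) ⟩
    term (inj₁ s) + 0 ≡⟨ +-identityʳ (term (inj₁ s)) ⟩
    term (inj₁ s)     ≡⟨ pointMass-at k (inj₁ s) _ ⟩
    k * indicator (member N z (inj₁ s)) ∎
    where
    term : EdgeIx n m → ℕ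
    term e′ = pointMass k (inj₁ s) e′ * indicator (member N z e′)
  deg-pointMass k (inj₂ i) z = begin
    ∑ (term ∘ inj₁) + ∑ (term ∘ inj₂)
      ≡⟨ cong₂ _+_ (∑-zero (term ∘ inj₁) λ s → pointMass-off k (inj₂ i) (inj₁ s) λ ())
                   (∑-single i (term ∘ inj₂) λ j j≢i → pointMass-off k (inj₂ i) (inj₂ j) (j≢i ∘ inj₂-injective)) ⟩
    0 + term (inj₂ i) ≡⟨ pointMass-at k (inj₂ i) _ ⟩
    k * indicator (member N z (inj₂ i)) ∎
    where
    term : EdgeIx n m → ℕ
    term e′ = pointMass k (inj₂ i) e′ * indicator (member N z e′)

  almostBalanced-transfer : ∀ e {a b} → T (member N a e) → T (member N b e) → ¬ a ≡ b →
    (∀ z → T (member N z e) → z ≡ a ⊎ z ≡ b) → AlmostBalanced N a → AlmostBalanced N b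
  almostBalanced-transfer e {a} {b} a∈e b∈e a≢b e⊆ab (Er , Eb , k , 0<k , excess-a , balanced) =
    Eb +ᴹ pointMass k e , Er , k , 0<k , excess-b , balanced′
    where
    shifted : ∀ z → deg N (Eb +ᴹ pointMass k e) z ≡ deg N Eb z + k * indicator (member N z e)
    shifted z = begin
      deg N (Eb +ᴹ pointMass k e) z               ≡⟨ deg-+ᴹ Eb (pointMass k e) z ⟩
      deg N Eb z + deg N (pointMass k e) z        ≡⟨ cong (deg N Eb z +_) (deg-pointMass k e z) ⟩
      deg N Eb z + k * indicator (member N z e)   ∎

    shifted-∈ : ∀ z → T (member N z e) → deg N (Eb +ᴹ pointMass k e) z ≡ deg N Eb z + k
    shifted-∈ z z∈e = begin
      deg N (Eb +ᴹ pointMass k e) z ≡⟨ shifted z ⟩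
      deg N Eb z + k * indicator (member N z e) ≡⟨ cong (λ t → deg N Eb z + k * t) (indicator-T _ z∈e) ⟩
      deg N Eb z + k * 1 ≡⟨ cong (deg N Eb z +_) (*-identityʳ k) ⟩
      deg N Eb z + k ∎

    excess-b : deg N (Eb +ᴹ pointMass k e) b ≡ deg N Er b + k
    excess-b = begin
      deg N (Eb +ᴹ pointMass k e) b ≡⟨ shifted-∈ b b∈e ⟩
      deg N Eb b + k                ≡⟨ cong (_+ k) (sym (balanced b (a≢b ∘ sym))) ⟩
      deg N Er b + k                ∎

    balanced′ : ∀ z → ¬ z ≡ b → deg N (Eb +ᴹ pointMass k e) z ≡ deg N Er z
    balanced′ z z≢b with z ≟ⱽ a
    ... | yes refl = begin
      deg N (Eb +ᴹ pointMass k e) a ≡⟨ shifted-∈ a a∈e ⟩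
      deg N Eb a + k                ≡⟨ sym excess-a ⟩
      deg N Er a                    ∎
    ... | no z≢a = begin
      deg N (Eb +ᴹ pointMass k e) z ≡⟨ shifted z ⟩
      deg N Eb z + k * indicator (member N z e) ≡⟨ cong (λ t → deg N Eb z + k * t) (indicator-¬T _ z∉e) ⟩
      deg N Eb z + k * 0 ≡⟨ cong (deg N Eb z +_) (*-zeroʳ k) ⟩
      deg N Eb z + 0     ≡⟨ +-identityʳ _ ⟩
      deg N Eb z         ≡⟨ sym (balanced z z≢a) ⟩
      deg N Er z         ∎
      where
      z∉e : ¬ T (member N z e)
      z∉e = [ z≢a , z≢b ]′ ∘ e⊆ab z

  reactionEdge-endpoints : ∀ i → T (nonzeroComplex (product N i)) →
    T (member N (u i) (inj₂ i)) × T (member N (v i) (inj₂ i))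
  reactionEdge-endpoints i y′≢∅ rewrite dec-true (i ≟ᶠ i) refl = y′≢∅ , y′≢∅

  reactionEdge-members : ∀ i z → T (member N z (inj₂ i)) → z ≡ u i ⊎ z ≡ v i
  reactionEdge-members i (u j) z∈e with j ≟ᶠ i | z∈e
  ... | yes refl | _ = inj₁ refl
  ... | no _     | ()
  reactionEdge-members i (v j) z∈e with j ≟ᶠ i | z∈e
  ... | yes refl | _ = inj₂ refl
  ... | no _     | ()

proposition3p8 : {n m : ℕ} (N : CRN n m) (i : Fin m) →
    ¬ IsZeroComplex (product N i) →
    AlmostBalanced N (u i) ⇔ AlmostBalanced N (v i)
proposition3p8 N i y′≢∅ =
  mk⇔ (almostBalanced-transfer N (inj₂ i) u∈Eᵢ v∈Eᵢ (λ ()) (reactionEdge-members N i))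
      (almostBalanced-transfer N (inj₂ i) v∈Eᵢ u∈Eᵢ (λ ()) (λ z → swap ∘ reactionEdge-members N i z))
  where
  endpoints : T (member N (u i) (inj₂ i)) × T (member N (v i) (inj₂ i))
  endpoints = reactionEdge-endpoints N i (nonzeroComplex-holds y′≢∅)
  u∈Eᵢ : T (member N (u i) (inj₂ i))
  u∈Eᵢ = proj₁ endpoints
  v∈Eᵢ : T (member N (v i) (inj₂ i))
  v∈Eᵢ = proj₂ endpoints
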